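{- Let $\psi\in\mathcal{D}$ be a DQBF and let $\psi_1=\forall x:(\varphi_1\wedge\varphi_2)$ be a subformula of $\psi$ with $x\notin V_{\varphi_1}$. Let $\psi'$ result from $\psi$ by replacing the subformula $\psi_1$ by $\psi_2=(\varphi_1^{ -x}\wedge(\forall x:\varphi_2))$, where $\varphi_1^{ -x}$ is $\varphi_1$ with $x$ removed from the dependency sets of all its existential variables. Then $\psi$ and $\psi'$ are equisatisfiable.
   Context: Notation: $\mathcal{F}(W)$ is the set of Boolean functions over variable set $W$; $\mathrm{supp}(f)$ the set of variables $f$ depends on. Syntax (non-closed non-prenex DQBFs in NNF over a finite variable set $V$). The set $\mathcal{D}$, with for each $\psi$ the sets $V^{\exists}_\psi$ (existential), $V^{\forall}_\psi$ (universal), $V^{\mathrm{fs}}_\psi$ (free variables occurring in $\psi$), and a dependency set $D_y\subseteq V$ for each existential $y$, is the smallest set closed under: (1) $v\in\mathcal{D}$ for $v\in V$ ($V^\exists=V^\forall=\emptyset$, $V^{\mathrm{fs}}=\{v\}$); (2) $\neg v\in\mathcal{D}$, same sets; (3),(4) if $\varphi_1,\varphi_2\in\mathcal{D}$ and $\bigl(V^Q_{\varphi_1}\cup V^{\mathrm{fs}}_{\varphi_1}\cup\bigcup_{y\in V^\exists_{\varphi_1}}D_y\bigr)\cap V^Q_{\varphi_2}=\emptyset$ and symmetrically, then $(\varphi_1\wedge\varphi_2),(\varphi_1\vee\varphi_2)\in\mathcal{D}$ with all three sets the unions; (5) if $\varphi\in\mathcal{D}$, $v\in V^{\mathrm{free}}_\varphi$,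 $D_v\subseteq V\setminus(V^Q_\varphi\cup\{v\})$, then $\exists v(D_v):\varphi^{ -v}\in\mathcal{D}$ ($\varphi^{ -v}$: remove $v$ from all dependency sets in $\varphi$), with $V^\exists=V^\exists_\varphi\cup\{v\}$, $V^{\mathrm{fs}}=V^{\mathrm{fs}}_\varphi\setminus\{v\}$; (6) if $\varphi\in\mathcal{D}$, $v\in V^{\mathrm{free}}_\varphi$, then $\forall v:\varphi\in\mathcal{D}$ with $V^\forall=V^\forall_\varphi\cup\{v\}$, $V^{\mathrm{fs}}=V^{\mathrm{fs}}_\varphi\setminus\{v\}$. Here $V^Q_\psi=V^\exists_\psi\cup V^\forall_\psi$, $V_\psi=V^Q_\psi\cup V^{\mathrm{fs}}_\psi$, $V^{\mathrm{free}}_\psi=V\setminus V^Q_\psi$. Semantics. A Skolem function candidate for $\psi$ is a map $s:V^{\mathrm{free}}_\psi\cup V^\exists_\psi\to\mathcal{F}(V^\forall_\psi)$ with $s(v)$ constant for free $v$ and $\mathrm{supp}(s(v))\subseteq D_v\cap V^\forall_\psi$ for existential $v$. $s(\psi)$ replaces each such $v$ by $s(v)$ and deletes quantifiers. $[\![\psi]\!]$ is the set of candidates $s$ with $s(\psi)$ a tautology. $\psi_1\approx\psi_2$ (equisatisfiable) iff $[\![\psi_1]\!]=\emptyset\Leftrightarrow[\![\psi_2]\!]=\emptyset$. -}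

module Defs where

open import Data.Nat using (ℕ)
open import Data.Fin using (Fin; _≟_)
open import Data.Bool using (Bool; true; false; _∧_; _∨_; not; if_then_else_)
open import Data.Product using (Σ; _×_; _,_)
open import Data.Sum using (_⊎_)
open import Data.Empty using (⊥)
open import Relation.Nullary using (¬_)
open import Relation.Nullary.Decidable using (⌊_⌋)
open import Relation.Binary.PropositionalEquality using (_≡_)

-- The finite variable set V is Fin n.  Subsets of V are Boolean
-- characteristic functions.

VSet : ℕ → Set
VSet n = Fin n → Bool

module _ {n : ℕ} where

  ∅ₛ : VSet n
  ∅ₛ _ = false

  ⟦_⟧ₛ : Fin n → VSet n
  ⟦ v ⟧ₛ w = ⌊ v ≟ w ⌋

  _∪ₛ_ : VSet n → VSet n → VSet n
  (A ∪ₛ B) w = A w ∨ B w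

  _∩ₛ_ : VSet n → VSet n → VSet n
  (A ∩ₛ B) w = A w ∧ B w

  _∖ₛ_ : VSet n → VSet n → VSet n
  (A ∖ₛ B) w = A w ∧ not (B w)

  _∈ₛ_ : Fin n → VSet n → Set
  w ∈ₛ A = A w ≡ true

  _∉ₛ_ : Fin n → VSet n → Set
  w ∉ₛ A = ¬ (w ∈ₛ A)

-- Raw syntax of (non-prenex, non-closed) DQBFs in NNF.
-- ∃ᶠ v D φ  stands for  ∃ v(D) : φ   (D is the dependency set D_v).

data Form (n : ℕ) : Set where
  var   : Fin n → Form n
  neg   : Fin n → Form n
  _∧ᶠ_  : Form n → Form n → Form n
  _∨ᶠ_  : Form n → Form n → Form n
  ∃ᶠ    : Fin n → VSet n → Form n → Form n
  ∀ᶠ    : Fin n → Form n → Form n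

module _ {n : ℕ} where

  Vex : Form n → VSet n
  Vex (var v) = ∅ₛ
  Vex (neg v) = ∅ₛ
  Vex (φ ∧ᶠ ψ) = Vex φ ∪ₛ Vex ψ
  Vex (φ ∨ᶠ ψ) = Vex φ ∪ₛ Vex ψ
  Vex (∃ᶠ v D φ) = Vex φ ∪ₛ ⟦ v ⟧ₛ
  Vex (∀ᶠ v φ) = Vex φ

  Vall : Form n → VSet n
  Vall (var v) = ∅ₛ
  Vall (neg v) = ∅ₛ
  Vall (φ ∧ᶠ ψ) = Vall φ ∪ₛ Vall ψ
  Vall (φ ∨ᶠ ψ) = Vall φ ∪ₛ Vall ψ
  Vall (∃ᶠ v D φ) = Vall φ
  Vall (∀ᶠ v φ) = Vall φ ∪ₛ ⟦ v ⟧ₛ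

  Vfs : Form n → VSet n
  Vfs (var v) = ⟦ v ⟧ₛ
  Vfs (neg v) = ⟦ v ⟧ₛ
  Vfs (φ ∧ᶠ ψ) = Vfs φ ∪ₛ Vfs ψ
  Vfs (φ ∨ᶠ ψ) = Vfs φ ∪ₛ Vfs ψ
  Vfs (∃ᶠ v D φ) = Vfs φ ∖ₛ ⟦ v ⟧ₛ
  Vfs (∀ᶠ v φ) = Vfs φ ∖ₛ ⟦ v ⟧ₛ

  VQ : Form n → VSet n
  VQ φ = Vex φ ∪ₛ Vall φ

  Vvars : Form n → VSet n
  Vvars φ = VQ φ ∪ₛ Vfs φ

  Vfree : Form n → VSet n
  Vfree φ w = not (VQ φ w)

  -- D_y: the dependency set attached to the binder of the existential y
  -- (in a well-formed formula every variable is bound at most once).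
  dep : Form n → Fin n → VSet n
  dep (var v) y = ∅ₛ
  dep (neg v) y = ∅ₛ
  dep (φ ∧ᶠ ψ) y = dep φ y ∪ₛ dep ψ y
  dep (φ ∨ᶠ ψ) y = dep φ y ∪ₛ dep ψ y
  dep (∃ᶠ v D φ) y w = (⌊ v ≟ y ⌋ ∧ D w) ∨ dep φ y w
  dep (∀ᶠ v φ) y = dep φ y

  removeDep : Fin n → Form n → Form n
  removeDep x (var v) = var v
  removeDep x (neg v) = neg v
  removeDep x (φ ∧ᶠ ψ) = removeDep x φ ∧ᶠ removeDep x ψ
  removeDep x (φ ∨ᶠ ψ) = removeDep x φ ∨ᶠ removeDep x ψ
  removeDep x (∃ᶠ v D φ) = ∃ᶠ v (D ∖ₛ ⟦ x ⟧ₛ) (removeDep x φ)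
  removeDep x (∀ᶠ v φ) = ∀ᶠ v (removeDep x φ)

  InDepsOfEx : Form n → Fin n → Set
  InDepsOfEx φ w = Σ (Fin n) λ y → (y ∈ₛ Vex φ) × (w ∈ₛ dep φ y)

  Sep : Form n → Form n → Set
  Sep φ₁ φ₂ = ∀ w → ((w ∈ₛ VQ φ₁) ⊎ (w ∈ₛ Vfs φ₁) ⊎ InDepsOfEx φ₁ w)
                  → w ∈ₛ VQ φ₂ → ⊥

  -- Membership in the class 𝒟 (rules (1)–(6)).
  data WF : Form n → Set where
    wf-var : ∀ v → WF (var v)
    wf-neg : ∀ v → WF (neg v)
    wf-∧ : ∀ {φ₁ φ₂} → WF φ₁ → WF φ₂ → Sep φ₁ φ₂ → Sep φ₂ φ₁ → WF (φ₁ ∧ᶠ φ₂)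
    wf-∨ : ∀ {φ₁ φ₂} → WF φ₁ → WF φ₂ → Sep φ₁ φ₂ → Sep φ₂ φ₁ → WF (φ₁ ∨ᶠ φ₂)
    wf-∃ : ∀ {φ} v (D : VSet n) → WF φ → v ∈ₛ Vfree φ
         → (∀ w → w ∈ₛ D → (w ∈ₛ VQ φ) ⊎ (w ≡ v) → ⊥)
         → WF (∃ᶠ v D (removeDep v φ))
    wf-∀ : ∀ {φ} v → WF φ → v ∈ₛ Vfree φ → WF (∀ᶠ v φ)

-- Semantics.  A Boolean function over W is represented as a function
-- of a total assignment of V that depends only on variables in W.

Assignment : ℕ → Set
Assignment n = Fin n → Bool

BFun : ℕ → Set
BFun n = Assignment n → Bool

module _ {n : ℕ} where

  SuppIn : BFun n → VSet n → Set
  SuppIn f S = ∀ (α β : Assignment n) → (∀ w → w ∈ₛ S → α w ≡ β w) → f α ≡ f β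

  -- Skolem function candidate (values at universal variables are ignored)
  IsCandidate : Form n → (Fin n → BFun n) → Set
  IsCandidate ψ s =
    (∀ v → v ∈ₛ Vfree ψ → SuppIn (s v) ∅ₛ) ×
    (∀ v → v ∈ₛ Vex ψ → SuppIn (s v) (dep ψ v ∩ₛ Vall ψ))

  evalP : (Fin n → Bool) → Form n → Bool
  evalP ρ (var v) = ρ v
  evalP ρ (neg v) = not (ρ v)
  evalP ρ (φ ∧ᶠ ψ) = evalP ρ φ ∧ evalP ρ ψ
  evalP ρ (φ ∨ᶠ ψ) = evalP ρ φ ∨ evalP ρ ψ
  evalP ρ (∃ᶠ v D φ) = evalP ρ φ
  evalP ρ (∀ᶠ v φ) = evalP ρ φ

  valueOf : Form n → (Fin n → BFun n) → Assignment n → Fin n → Bool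
  valueOf ψ s α v = if Vall ψ v then α v else s v α

  Taut : Form n → (Fin n → BFun n) → Set
  Taut ψ s = ∀ (α : Assignment n) → evalP (valueOf ψ s α) ψ ≡ true

  Models : Form n → (Fin n → BFun n) → Set
  Models ψ s = IsCandidate ψ s × Taut ψ s

  Sat : Form n → Set
  Sat ψ = Σ (Fin n → BFun n) λ s → Models ψ s

  Equisat : Form n → Form n → Set
  Equisat ψ₁ ψ₂ = (¬ Sat ψ₁ → ¬ Sat ψ₂) × (¬ Sat ψ₂ → ¬ Sat ψ₁)

data Ctx (n : ℕ) : Set where
  hole : Ctx n
  ∧L : Ctx n → Form n → Ctx n
  ∧R : Form n → Ctx n → Ctx n
  ∨L : Ctx n → Form n → Ctx n
  ∨R : Form n → Ctx n → Ctx n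
  ∃C : Fin n → VSet n → Ctx n → Ctx n
  ∀C : Fin n → Ctx n → Ctx n

plug : ∀ {n} → Ctx n → Form n → Form n
plug hole χ = χ
plug (∧L C φ) χ = plug C χ ∧ᶠ φ
plug (∧R φ C) χ = φ ∧ᶠ plug C χ
plug (∨L C φ) χ = plug C χ ∨ᶠ φ
plug (∨R φ C) χ = φ ∨ᶠ plug C χ
plug (∃C v D C) χ = ∃ᶠ v D (plug C χ)
plug (∀C v C) χ = ∀ᶠ v (plug C χ)

-- Every model of ψ′ = C[φ₁^{-x} ∧ ∀x φ₂] is a model of ψ = C[∀x (φ₁ ∧ φ₂)]: both formulas have the same
-- quantified variables and the same matrix, and the dependency sets of ψ′ are contained in those of ψ.
-- Conversely, let s be a model of ψ and let the existentials of φ₁ read s at α[x := false] instead of α.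
-- Well-scopedness keeps x out of φ₁ and out of the dependency sets of the variables occurring in C, so
-- under the new functions C sees its values at α (equivalently at α[x := false]), φ₁ its values at
-- α[x := false] and φ₂ its values at α. Since s satisfies ψ at both assignments and C is monotone in its
-- hole (NNF), the value C[φ₁(α[x := false]) ∧ φ₂(α)] is true as well.
module Submission where

open import Defs
open import Data.Nat using (ℕ)
open import Data.Fin using (Fin; _≟_)
open import Data.Bool using (Bool; true; false; _∧_; _∨_; not; if_then_else_)
open import Data.Bool.Properties
  using (∨-assoc; ∧-assoc; ∧-distribʳ-∨; ¬-not; if-cong; if-cong-else; if-cong₂)
  renaming (_≟_ to _≟ᵇ_)
open import Data.Product using (_,_; proj₁; proj₂)
open import Data.Sum using (_⊎_; inj₁; inj₂)
open import Data.Empty using (⊥; ⊥-elim)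
open import Function using (_∘_)
open import Relation.Nullary using (Dec; yes; no)
open import Relation.Nullary.Decidable using (⌊_⌋; isYes≗does; dec-true; dec-false)
open import Relation.Binary.PropositionalEquality
  using (_≡_; _≢_; _≗_; refl; sym; trans; cong; cong₂; module ≡-Reasoning)

∨-introˡ : ∀ {a b} → a ≡ true → a ∨ b ≡ true
∨-introˡ refl = refl

∨-introʳ : ∀ {a b} → b ≡ true → a ∨ b ≡ true
∨-introʳ {true}  _ = refl
∨-introʳ {false} p = p

∨-elim : ∀ {a b} → a ∨ b ≡ true → a ≡ true ⊎ b ≡ true
∨-elim {true}  _ = inj₁ refl
∨-elim {false} p = inj₂ p

∧-intro : ∀ {a b} → a ≡ true → b ≡ true → a ∧ b ≡ true
∧-intro refl p = p

∧-elimˡ : ∀ {a b} → a ∧ b ≡ true → a ≡ true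
∧-elimˡ {true} _ = refl

∧-elimʳ : ∀ {a b} → a ∧ b ≡ true → b ≡ true
∧-elimʳ {true} p = p

-- If K false holds, so does every value of K; otherwise both conjunctions in the premises are true.
monotone-∧-swap : (K : Bool → Bool) → (K false ≡ true → K true ≡ true) →
                  ∀ a₁ b₁ a₂ b₂ → K (a₁ ∧ b₁) ≡ true → K (a₂ ∧ b₂) ≡ true → K (a₂ ∧ b₁) ≡ true
monotone-∧-swap K mono a₁    b₁    false b₂    _  k₂ = k₂
monotone-∧-swap K mono true  false true  b₂    k₁ _  = k₁
monotone-∧-swap K mono false false true  b₂    k₁ _  = k₁
monotone-∧-swap K mono a₁    true  true  true  _  k₂ = k₂
monotone-∧-swap K mono a₁    true  true  false _  k₂ = mono k₂

module _ {n : ℕ} where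

  _∈ₛ?_ : ∀ (w : Fin n) A → Dec (w ∈ₛ A)
  w ∈ₛ? A = A w ≟ᵇ true

  ∈-⟦⟧ : (v : Fin n) → v ∈ₛ ⟦ v ⟧ₛ
  ∈-⟦⟧ v = trans (isYes≗does (v ≟ v)) (dec-true (v ≟ v) refl)

  ∉-⟦⟧ : ∀ {v w : Fin n} → v ≢ w → ⟦ v ⟧ₛ w ≡ false
  ∉-⟦⟧ {v} {w} v≢w = trans (isYes≗does (v ≟ w)) (dec-false (v ≟ w) v≢w)

  module _ (x : Fin n) where

    Vex-removeDep : ∀ φ → Vex (removeDep x φ) ≗ Vex φ
    Vex-removeDep (var v)    w = refl
    Vex-removeDep (neg v)    w = refl
    Vex-removeDep (φ ∧ᶠ ψ)   w = cong₂ _∨_ (Vex-removeDep φ w) (Vex-removeDep ψ w)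
    Vex-removeDep (φ ∨ᶠ ψ)   w = cong₂ _∨_ (Vex-removeDep φ w) (Vex-removeDep ψ w)
    Vex-removeDep (∃ᶠ v D φ) w = cong (_∨ ⌊ v ≟ w ⌋) (Vex-removeDep φ w)
    Vex-removeDep (∀ᶠ v φ)   w = Vex-removeDep φ w

    Vall-removeDep : ∀ φ → Vall (removeDep x φ) ≗ Vall φ
    Vall-removeDep (var v)    w = refl
    Vall-removeDep (neg v)    w = refl
    Vall-removeDep (φ ∧ᶠ ψ)   w = cong₂ _∨_ (Vall-removeDep φ w) (Vall-removeDep ψ w)
    Vall-removeDep (φ ∨ᶠ ψ)   w = cong₂ _∨_ (Vall-removeDep φ w) (Vall-removeDep ψ w)
    Vall-removeDep (∃ᶠ v D φ) w = Vall-removeDep φ w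
    Vall-removeDep (∀ᶠ v φ)   w = cong (_∨ ⌊ v ≟ w ⌋) (Vall-removeDep φ w)

    Vfs-removeDep : ∀ φ → Vfs (removeDep x φ) ≗ Vfs φ
    Vfs-removeDep (var v)    w = refl
    Vfs-removeDep (neg v)    w = refl
    Vfs-removeDep (φ ∧ᶠ ψ)   w = cong₂ _∨_ (Vfs-removeDep φ w) (Vfs-removeDep ψ w)
    Vfs-removeDep (φ ∨ᶠ ψ)   w = cong₂ _∨_ (Vfs-removeDep φ w) (Vfs-removeDep ψ w)
    Vfs-removeDep (∃ᶠ v D φ) w = cong (_∧ not ⌊ v ≟ w ⌋) (Vfs-removeDep φ w)
    Vfs-removeDep (∀ᶠ v φ)   w = cong (_∧ not ⌊ v ≟ w ⌋) (Vfs-removeDep φ w)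

    VQ-removeDep : ∀ φ → VQ (removeDep x φ) ≗ VQ φ
    VQ-removeDep φ w = cong₂ _∨_ (Vex-removeDep φ w) (Vall-removeDep φ w)

    evalP-removeDep : ∀ ρ φ → evalP ρ (removeDep x φ) ≡ evalP ρ φ
    evalP-removeDep ρ (var v)    = refl
    evalP-removeDep ρ (neg v)    = refl
    evalP-removeDep ρ (φ ∧ᶠ ψ)   = cong₂ _∧_ (evalP-removeDep ρ φ) (evalP-removeDep ρ ψ)
    evalP-removeDep ρ (φ ∨ᶠ ψ)   = cong₂ _∨_ (evalP-removeDep ρ φ) (evalP-removeDep ρ ψ)
    evalP-removeDep ρ (∃ᶠ v D φ) = evalP-removeDep ρ φ
    evalP-removeDep ρ (∀ᶠ v φ)   = evalP-removeDep ρ φ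

    dep-removeDep : ∀ φ y → dep (removeDep x φ) y ≗ dep φ y ∖ₛ ⟦ x ⟧ₛ
    dep-removeDep (var v)    y w = refl
    dep-removeDep (neg v)    y w = refl
    dep-removeDep (φ ∧ᶠ ψ)   y w = trans (cong₂ _∨_ (dep-removeDep φ y w) (dep-removeDep ψ y w))
                                         (sym (∧-distribʳ-∨ _ (dep φ y w) (dep ψ y w)))
    dep-removeDep (φ ∨ᶠ ψ)   y w = trans (cong₂ _∨_ (dep-removeDep φ y w) (dep-removeDep ψ y w))
                                         (sym (∧-distribʳ-∨ _ (dep φ y w) (dep ψ y w)))
    dep-removeDep (∃ᶠ v D φ) y w = trans (cong₂ _∨_ (sym (∧-assoc ⌊ v ≟ y ⌋ (D w) _))
                                                     (dep-removeDep φ y w))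
                                         (sym (∧-distribʳ-∨ _ (⌊ v ≟ y ⌋ ∧ D w) (dep φ y w)))
    dep-removeDep (∀ᶠ v φ)   y w = dep-removeDep φ y w

  dep⇒Vex : ∀ φ {y w : Fin n} → w ∈ₛ dep φ y → y ∈ₛ Vex φ
  dep⇒Vex (φ ∧ᶠ ψ) {y} {w} d with ∨-elim {dep φ y w} d
  ... | inj₁ d₁ = ∨-introˡ (dep⇒Vex φ d₁)
  ... | inj₂ d₂ = ∨-introʳ {Vex φ y} (dep⇒Vex ψ d₂)
  dep⇒Vex (φ ∨ᶠ ψ) {y} {w} d with ∨-elim {dep φ y w} d
  ... | inj₁ d₁ = ∨-introˡ (dep⇒Vex φ d₁)
  ... | inj₂ d₂ = ∨-introʳ {Vex φ y} (dep⇒Vex ψ d₂)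
  dep⇒Vex (∃ᶠ v D φ) {y} {w} d with ∨-elim {⌊ v ≟ y ⌋ ∧ D w} d
  ... | inj₁ here = ∨-introʳ {Vex φ y} (∧-elimˡ {⌊ v ≟ y ⌋} here)
  ... | inj₂ d′   = ∨-introˡ (dep⇒Vex φ d′)
  dep⇒Vex (∀ᶠ v φ) d = dep⇒Vex φ d

  _occursIn_ : Fin n → Form n → Set
  w occursIn var v    = v ≡ w
  w occursIn neg v    = v ≡ w
  w occursIn (φ ∧ᶠ ψ) = w occursIn φ ⊎ w occursIn ψ
  w occursIn (φ ∨ᶠ ψ) = w occursIn φ ⊎ w occursIn ψ
  w occursIn ∃ᶠ v D φ = w occursIn φ
  w occursIn ∀ᶠ v φ   = w occursIn φ

  _occursInCtx_ : Fin n → Ctx n → Set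
  w occursInCtx hole      = ⊥
  w occursInCtx ∧L C φ    = w occursInCtx C ⊎ w occursIn φ
  w occursInCtx ∧R φ C    = w occursIn φ ⊎ w occursInCtx C
  w occursInCtx ∨L C φ    = w occursInCtx C ⊎ w occursIn φ
  w occursInCtx ∨R φ C    = w occursIn φ ⊎ w occursInCtx C
  w occursInCtx ∃C v D C  = w occursInCtx C
  w occursInCtx ∀C v C    = w occursInCtx C

  Used : Form n → Fin n → Set
  Used φ w = (w ∈ₛ VQ φ) ⊎ (w ∈ₛ Vfs φ) ⊎ InDepsOfEx φ w

  -- The variable sets of φ ∨ᶠ ψ and φ ∧ᶠ ψ are definitionally equal; the ∨ᶠ cases reuse the ∧ᶠ lemmas.
  module _ {w : Fin n} where

    VQ-∧ˡ : ∀ φ ψ → w ∈ₛ VQ φ → w ∈ₛ VQ (φ ∧ᶠ ψ)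
    VQ-∧ˡ φ ψ q with ∨-elim {Vex φ w} q
    ... | inj₁ e = ∨-introˡ (∨-introˡ e)
    ... | inj₂ a = ∨-introʳ {Vex φ w ∨ Vex ψ w} (∨-introˡ a)

    VQ-∧ʳ : ∀ φ ψ → w ∈ₛ VQ ψ → w ∈ₛ VQ (φ ∧ᶠ ψ)
    VQ-∧ʳ φ ψ q with ∨-elim {Vex ψ w} q
    ... | inj₁ e = ∨-introˡ (∨-introʳ {Vex φ w} e)
    ... | inj₂ a = ∨-introʳ {Vex φ w ∨ Vex ψ w} (∨-introʳ {Vall φ w} a)

    VQ-∃ : ∀ v D φ → w ∈ₛ VQ φ → w ∈ₛ VQ (∃ᶠ v D φ)
    VQ-∃ v D φ q with ∨-elim {Vex φ w} q
    ... | inj₁ e = ∨-introˡ (∨-introˡ e)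
    ... | inj₂ a = ∨-introʳ {Vex φ w ∨ ⌊ v ≟ w ⌋} a

    VQ-∀ : ∀ v φ → w ∈ₛ VQ φ → w ∈ₛ VQ (∀ᶠ v φ)
    VQ-∀ v φ q with ∨-elim {Vex φ w} q
    ... | inj₁ e = ∨-introˡ e
    ... | inj₂ a = ∨-introʳ {Vex φ w} (∨-introˡ a)

    VQ-plug : ∀ C χ → w ∈ₛ VQ χ → w ∈ₛ VQ (plug C χ)
    VQ-plug hole       χ q = q
    VQ-plug (∧L C φ)   χ q = VQ-∧ˡ (plug C χ) φ (VQ-plug C χ q)
    VQ-plug (∧R φ C)   χ q = VQ-∧ʳ φ (plug C χ) (VQ-plug C χ q)
    VQ-plug (∨L C φ)   χ q = VQ-∧ˡ (plug C χ) φ (VQ-plug C χ q)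
    VQ-plug (∨R φ C)   χ q = VQ-∧ʳ φ (plug C χ) (VQ-plug C χ q)
    VQ-plug (∃C v D C) χ q = VQ-∃ v D (plug C χ) (VQ-plug C χ q)
    VQ-plug (∀C v C)   χ q = VQ-∀ v (plug C χ) (VQ-plug C χ q)

    Vvars-lift : ∀ φ φ′ → (w ∈ₛ VQ φ → w ∈ₛ VQ φ′) → (w ∈ₛ Vfs φ → w ∈ₛ Vvars φ′) →
                 w ∈ₛ Vvars φ → w ∈ₛ Vvars φ′
    Vvars-lift φ φ′ VQ⊆ Vfs⊆ p with ∨-elim {VQ φ w} p
    ... | inj₁ q = ∨-introˡ (VQ⊆ q)
    ... | inj₂ f = Vfs⊆ f

    Vfs⇒Vvars-∃ : ∀ v D φ → w ∈ₛ Vfs φ → w ∈ₛ Vvars (∃ᶠ v D φ)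
    Vfs⇒Vvars-∃ v D φ f with ⌊ v ≟ w ⌋
    ... | true  = ∨-introˡ (∨-introˡ (∨-introʳ {Vex φ w} refl))
    ... | false = ∨-introʳ {(Vex φ w ∨ false) ∨ Vall φ w} (∧-intro f refl)

    Vfs⇒Vvars-∀ : ∀ v φ → w ∈ₛ Vfs φ → w ∈ₛ Vvars (∀ᶠ v φ)
    Vfs⇒Vvars-∀ v φ f with ⌊ v ≟ w ⌋
    ... | true  = ∨-introˡ (∨-introʳ {Vex φ w} (∨-introʳ {Vall φ w} refl))
    ... | false = ∨-introʳ {Vex φ w ∨ (Vall φ w ∨ false)} (∧-intro f refl)

    Vvars-∧ˡ : ∀ φ ψ → w ∈ₛ Vvars φ → w ∈ₛ Vvars (φ ∧ᶠ ψ)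
    Vvars-∧ˡ φ ψ = Vvars-lift φ (φ ∧ᶠ ψ) (VQ-∧ˡ φ ψ) (λ f → ∨-introʳ {VQ (φ ∧ᶠ ψ) w} (∨-introˡ f))

    Vvars-∧ʳ : ∀ φ ψ → w ∈ₛ Vvars ψ → w ∈ₛ Vvars (φ ∧ᶠ ψ)
    Vvars-∧ʳ φ ψ = Vvars-lift ψ (φ ∧ᶠ ψ) (VQ-∧ʳ φ ψ)
                              (λ f → ∨-introʳ {VQ (φ ∧ᶠ ψ) w} (∨-introʳ {Vfs φ w} f))

    occursIn⇒Vvars : ∀ φ → w occursIn φ → w ∈ₛ Vvars φ
    occursIn⇒Vvars (var v)    refl     = ∨-introʳ {false} (∈-⟦⟧ w)
    occursIn⇒Vvars (neg v)    refl     = ∨-introʳ {false} (∈-⟦⟧ w)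
    occursIn⇒Vvars (φ ∧ᶠ ψ)   (inj₁ o) = Vvars-∧ˡ φ ψ (occursIn⇒Vvars φ o)
    occursIn⇒Vvars (φ ∧ᶠ ψ)   (inj₂ o) = Vvars-∧ʳ φ ψ (occursIn⇒Vvars ψ o)
    occursIn⇒Vvars (φ ∨ᶠ ψ)   (inj₁ o) = Vvars-∧ˡ φ ψ (occursIn⇒Vvars φ o)
    occursIn⇒Vvars (φ ∨ᶠ ψ)   (inj₂ o) = Vvars-∧ʳ φ ψ (occursIn⇒Vvars ψ o)
    occursIn⇒Vvars (∃ᶠ v D φ) o =
      Vvars-lift φ (∃ᶠ v D φ) (VQ-∃ v D φ) (Vfs⇒Vvars-∃ v D φ) (occursIn⇒Vvars φ o)
    occursIn⇒Vvars (∀ᶠ v φ)   o =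
      Vvars-lift φ (∀ᶠ v φ) (VQ-∀ v φ) (Vfs⇒Vvars-∀ v φ) (occursIn⇒Vvars φ o)

    occursIn⇒Used : ∀ φ → w occursIn φ → Used φ w
    occursIn⇒Used φ o with ∨-elim {VQ φ w} (occursIn⇒Vvars φ o)
    ... | inj₁ q = inj₁ q
    ... | inj₂ f = inj₂ (inj₁ f)

    dep⇒Used : ∀ φ {y} → w ∈ₛ dep φ y → Used φ w
    dep⇒Used φ {y} d = inj₂ (inj₂ (y , dep⇒Vex φ d , d))

  evalP-cong : ∀ φ {ρ ρ′ : Assignment n} → (∀ w → w occursIn φ → ρ w ≡ ρ′ w) → evalP ρ φ ≡ evalP ρ′ φ
  evalP-cong (var v)    eq = eq v refl
  evalP-cong (neg v)    eq = cong not (eq v refl)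
  evalP-cong (φ ∧ᶠ ψ)   eq = cong₂ _∧_ (evalP-cong φ (λ w → eq w ∘ inj₁)) (evalP-cong ψ (λ w → eq w ∘ inj₂))
  evalP-cong (φ ∨ᶠ ψ)   eq = cong₂ _∨_ (evalP-cong φ (λ w → eq w ∘ inj₁)) (evalP-cong ψ (λ w → eq w ∘ inj₂))
  evalP-cong (∃ᶠ v D φ) eq = evalP-cong φ eq
  evalP-cong (∀ᶠ v φ)   eq = evalP-cong φ eq

  evalCtx : Ctx n → Assignment n → Bool → Bool
  evalCtx hole       ρ b = b
  evalCtx (∧L C φ)   ρ b = evalCtx C ρ b ∧ evalP ρ φ
  evalCtx (∧R φ C)   ρ b = evalP ρ φ ∧ evalCtx C ρ b
  evalCtx (∨L C φ)   ρ b = evalCtx C ρ b ∨ evalP ρ φ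
  evalCtx (∨R φ C)   ρ b = evalP ρ φ ∨ evalCtx C ρ b
  evalCtx (∃C v D C) ρ b = evalCtx C ρ b
  evalCtx (∀C v C)   ρ b = evalCtx C ρ b

  evalP-plug : ∀ C ρ χ → evalP ρ (plug C χ) ≡ evalCtx C ρ (evalP ρ χ)
  evalP-plug hole       ρ χ = refl
  evalP-plug (∧L C φ)   ρ χ = cong (_∧ evalP ρ φ) (evalP-plug C ρ χ)
  evalP-plug (∧R φ C)   ρ χ = cong (evalP ρ φ ∧_) (evalP-plug C ρ χ)
  evalP-plug (∨L C φ)   ρ χ = cong (_∨ evalP ρ φ) (evalP-plug C ρ χ)
  evalP-plug (∨R φ C)   ρ χ = cong (evalP ρ φ ∨_) (evalP-plug C ρ χ)
  evalP-plug (∃C v D C) ρ χ = evalP-plug C ρ χ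
  evalP-plug (∀C v C)   ρ χ = evalP-plug C ρ χ

  evalCtx-monotone : ∀ C ρ → evalCtx C ρ false ≡ true → evalCtx C ρ true ≡ true
  evalCtx-monotone (∧L C φ) ρ h =
    ∧-intro (evalCtx-monotone C ρ (∧-elimˡ h)) (∧-elimʳ {evalCtx C ρ false} h)
  evalCtx-monotone (∧R φ C) ρ h = ∧-intro (∧-elimˡ h) (evalCtx-monotone C ρ (∧-elimʳ {evalP ρ φ} h))
  evalCtx-monotone (∨L C φ) ρ h with ∨-elim {evalCtx C ρ false} h
  ... | inj₁ l = ∨-introˡ (evalCtx-monotone C ρ l)
  ... | inj₂ r = ∨-introʳ {evalCtx C ρ true} r
  evalCtx-monotone (∨R φ C) ρ h with ∨-elim {evalP ρ φ} h
  ... | inj₁ l = ∨-introˡ l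
  ... | inj₂ r = ∨-introʳ {evalP ρ φ} (evalCtx-monotone C ρ r)
  evalCtx-monotone (∃C v D C) ρ h = evalCtx-monotone C ρ h
  evalCtx-monotone (∀C v C)   ρ h = evalCtx-monotone C ρ h

  evalCtx-cong : ∀ C {ρ ρ′ : Assignment n} b → (∀ w → w occursInCtx C → ρ w ≡ ρ′ w) →
                 evalCtx C ρ b ≡ evalCtx C ρ′ b
  evalCtx-cong hole       b eq = refl
  evalCtx-cong (∧L C φ)   b eq =
    cong₂ _∧_ (evalCtx-cong C b (λ w → eq w ∘ inj₁)) (evalP-cong φ (λ w → eq w ∘ inj₂))
  evalCtx-cong (∧R φ C)   b eq =
    cong₂ _∧_ (evalP-cong φ (λ w → eq w ∘ inj₁)) (evalCtx-cong C b (λ w → eq w ∘ inj₂))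
  evalCtx-cong (∨L C φ)   b eq =
    cong₂ _∨_ (evalCtx-cong C b (λ w → eq w ∘ inj₁)) (evalP-cong φ (λ w → eq w ∘ inj₂))
  evalCtx-cong (∨R φ C)   b eq =
    cong₂ _∨_ (evalP-cong φ (λ w → eq w ∘ inj₁)) (evalCtx-cong C b (λ w → eq w ∘ inj₂))
  evalCtx-cong (∃C v D C) b eq = evalCtx-cong C b eq
  evalCtx-cong (∀C v C)   b eq = evalCtx-cong C b eq

  module _ {χ χ′ : Form n} where

    Vex-plug : Vex χ′ ≗ Vex χ → ∀ C → Vex (plug C χ′) ≗ Vex (plug C χ)
    Vex-plug eq hole       w = eq w
    Vex-plug eq (∧L C φ)   w = cong (_∨ Vex φ w) (Vex-plug eq C w)
    Vex-plug eq (∧R φ C)   w = cong (Vex φ w ∨_) (Vex-plug eq C w)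
    Vex-plug eq (∨L C φ)   w = cong (_∨ Vex φ w) (Vex-plug eq C w)
    Vex-plug eq (∨R φ C)   w = cong (Vex φ w ∨_) (Vex-plug eq C w)
    Vex-plug eq (∃C v D C) w = cong (_∨ ⌊ v ≟ w ⌋) (Vex-plug eq C w)
    Vex-plug eq (∀C v C)   w = Vex-plug eq C w

    Vall-plug : Vall χ′ ≗ Vall χ → ∀ C → Vall (plug C χ′) ≗ Vall (plug C χ)
    Vall-plug eq hole       w = eq w
    Vall-plug eq (∧L C φ)   w = cong (_∨ Vall φ w) (Vall-plug eq C w)
    Vall-plug eq (∧R φ C)   w = cong (Vall φ w ∨_) (Vall-plug eq C w)
    Vall-plug eq (∨L C φ)   w = cong (_∨ Vall φ w) (Vall-plug eq C w)
    Vall-plug eq (∨R φ C)   w = cong (Vall φ w ∨_) (Vall-plug eq C w)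
    Vall-plug eq (∃C v D C) w = Vall-plug eq C w
    Vall-plug eq (∀C v C)   w = cong (_∨ ⌊ v ≟ w ⌋) (Vall-plug eq C w)

    dep-plug-mono : ∀ {y w} → (w ∈ₛ dep χ y → w ∈ₛ dep χ′ y) →
                    ∀ C → w ∈ₛ dep (plug C χ) y → w ∈ₛ dep (plug C χ′) y
    dep-plug-mono h hole d = h d
    dep-plug-mono {y} {w} h (∧L C φ) d with ∨-elim {dep (plug C χ) y w} d
    ... | inj₁ l = ∨-introˡ (dep-plug-mono h C l)
    ... | inj₂ r = ∨-introʳ {dep (plug C χ′) y w} r
    dep-plug-mono {y} {w} h (∧R φ C) d with ∨-elim {dep φ y w} d
    ... | inj₁ l = ∨-introˡ l
    ... | inj₂ r = ∨-introʳ {dep φ y w} (dep-plug-mono h C r)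
    dep-plug-mono {y} {w} h (∨L C φ) d with ∨-elim {dep (plug C χ) y w} d
    ... | inj₁ l = ∨-introˡ (dep-plug-mono h C l)
    ... | inj₂ r = ∨-introʳ {dep (plug C χ′) y w} r
    dep-plug-mono {y} {w} h (∨R φ C) d with ∨-elim {dep φ y w} d
    ... | inj₁ l = ∨-introˡ l
    ... | inj₂ r = ∨-introʳ {dep φ y w} (dep-plug-mono h C r)
    dep-plug-mono {y} {w} h (∃C v D C) d with ∨-elim {⌊ v ≟ y ⌋ ∧ D w} d
    ... | inj₁ l = ∨-introˡ l
    ... | inj₂ r = ∨-introʳ {⌊ v ≟ y ⌋ ∧ D w} (dep-plug-mono h C r)
    dep-plug-mono h (∀C v C) d = dep-plug-mono h C d

  -- WF without the side conditions v ∈ V^free_φ of rules (5) and (6). Unlike WF it is closed under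
  -- removeDep, which the ∃-rule of WF applies to its body.
  data Scoped : Form n → Set where
    scoped-var : ∀ v → Scoped (var v)
    scoped-neg : ∀ v → Scoped (neg v)
    scoped-∧   : ∀ {φ₁ φ₂} → Scoped φ₁ → Scoped φ₂ → Sep φ₁ φ₂ → Sep φ₂ φ₁ → Scoped (φ₁ ∧ᶠ φ₂)
    scoped-∨   : ∀ {φ₁ φ₂} → Scoped φ₁ → Scoped φ₂ → Sep φ₁ φ₂ → Sep φ₂ φ₁ → Scoped (φ₁ ∨ᶠ φ₂)
    scoped-∃   : ∀ {φ} v D → Scoped φ → (∀ w → w ∈ₛ D → w ∉ₛ VQ φ) → Scoped (∃ᶠ v D φ)
    scoped-∀   : ∀ {φ} v → Scoped φ → Scoped (∀ᶠ v φ)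

  module _ (x : Fin n) where

    Used-removeDep : ∀ φ {w} → Used (removeDep x φ) w → Used φ w
    Used-removeDep φ {w} (inj₁ q)                  = inj₁ (trans (sym (VQ-removeDep x φ w)) q)
    Used-removeDep φ {w} (inj₂ (inj₁ f))           = inj₂ (inj₁ (trans (sym (Vfs-removeDep x φ w)) f))
    Used-removeDep φ {w} (inj₂ (inj₂ (y , e , d))) =
      inj₂ (inj₂ (y , trans (sym (Vex-removeDep x φ y)) e ,
                      ∧-elimˡ (trans (sym (dep-removeDep x φ y w)) d)))

    Sep-removeDep : ∀ φ₁ φ₂ → Sep φ₁ φ₂ → Sep (removeDep x φ₁) (removeDep x φ₂)
    Sep-removeDep φ₁ φ₂ sep w u q = sep w (Used-removeDep φ₁ u) (trans (sym (VQ-removeDep x φ₂ w)) q)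

    Scoped-removeDep : ∀ {φ} → Scoped φ → Scoped (removeDep x φ)
    Scoped-removeDep (scoped-var v) = scoped-var v
    Scoped-removeDep (scoped-neg v) = scoped-neg v
    Scoped-removeDep (scoped-∧ {φ₁} {φ₂} s₁ s₂ sep₁₂ sep₂₁) =
      scoped-∧ (Scoped-removeDep s₁) (Scoped-removeDep s₂)
               (Sep-removeDep φ₁ φ₂ sep₁₂) (Sep-removeDep φ₂ φ₁ sep₂₁)
    Scoped-removeDep (scoped-∨ {φ₁} {φ₂} s₁ s₂ sep₁₂ sep₂₁) =
      scoped-∨ (Scoped-removeDep s₁) (Scoped-removeDep s₂)
               (Sep-removeDep φ₁ φ₂ sep₁₂) (Sep-removeDep φ₂ φ₁ sep₂₁)
    Scoped-removeDep (scoped-∃ {φ} v D s disj) =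
      scoped-∃ v _ (Scoped-removeDep s) (λ w d q → disj w (∧-elimˡ d) (trans (sym (VQ-removeDep x φ w)) q))
    Scoped-removeDep (scoped-∀ v s) = scoped-∀ v (Scoped-removeDep s)

  WF⇒Scoped : ∀ {φ} → WF φ → Scoped φ
  WF⇒Scoped (wf-var v) = scoped-var v
  WF⇒Scoped (wf-neg v) = scoped-neg v
  WF⇒Scoped (wf-∧ wf₁ wf₂ sep₁₂ sep₂₁) = scoped-∧ (WF⇒Scoped wf₁) (WF⇒Scoped wf₂) sep₁₂ sep₂₁
  WF⇒Scoped (wf-∨ wf₁ wf₂ sep₁₂ sep₂₁) = scoped-∨ (WF⇒Scoped wf₁) (WF⇒Scoped wf₂) sep₁₂ sep₂₁
  WF⇒Scoped (wf-∃ {φ} v D wf _ disj) =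
    scoped-∃ v D (Scoped-removeDep v (WF⇒Scoped wf))
             (λ w d q → disj w d (inj₁ (trans (sym (VQ-removeDep v φ w)) q)))
  WF⇒Scoped (wf-∀ v wf _) = scoped-∀ v (WF⇒Scoped wf)

  Scoped-hole : ∀ C {χ} → Scoped (plug C χ) → Scoped χ
  Scoped-hole hole       s                   = s
  Scoped-hole (∧L C φ)   (scoped-∧ s _ _ _)  = Scoped-hole C s
  Scoped-hole (∧R φ C)   (scoped-∧ _ s _ _)  = Scoped-hole C s
  Scoped-hole (∨L C φ)   (scoped-∨ s _ _ _)  = Scoped-hole C s
  Scoped-hole (∨R φ C)   (scoped-∨ _ s _ _)  = Scoped-hole C s
  Scoped-hole (∃C v D C) (scoped-∃ _ _ s _)  = Scoped-hole C s
  Scoped-hole (∀C v C)   (scoped-∀ _ s)      = Scoped-hole C s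

  ctxVar∉VQ-hole : ∀ C {χ w} → Scoped (plug C χ) → w occursInCtx C → w ∉ₛ VQ χ
  ctxVar∉VQ-hole (∧L C φ) (scoped-∧ s _ _ _) (inj₁ o) = ctxVar∉VQ-hole C s o
  ctxVar∉VQ-hole (∧L C φ) {χ} (scoped-∧ _ _ _ sep) (inj₂ o) q =
    sep _ (occursIn⇒Used φ o) (VQ-plug C χ q)
  ctxVar∉VQ-hole (∧R φ C) {χ} (scoped-∧ _ _ sep _) (inj₁ o) q =
    sep _ (occursIn⇒Used φ o) (VQ-plug C χ q)
  ctxVar∉VQ-hole (∧R φ C) (scoped-∧ _ s _ _) (inj₂ o) = ctxVar∉VQ-hole C s o
  ctxVar∉VQ-hole (∨L C φ) (scoped-∨ s _ _ _) (inj₁ o) = ctxVar∉VQ-hole C s o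
  ctxVar∉VQ-hole (∨L C φ) {χ} (scoped-∨ _ _ _ sep) (inj₂ o) q =
    sep _ (occursIn⇒Used φ o) (VQ-plug C χ q)
  ctxVar∉VQ-hole (∨R φ C) {χ} (scoped-∨ _ _ sep _) (inj₁ o) q =
    sep _ (occursIn⇒Used φ o) (VQ-plug C χ q)
  ctxVar∉VQ-hole (∨R φ C) (scoped-∨ _ s _ _) (inj₂ o) = ctxVar∉VQ-hole C s o
  ctxVar∉VQ-hole (∃C v D C) (scoped-∃ _ _ s _) o = ctxVar∉VQ-hole C s o
  ctxVar∉VQ-hole (∀C v C) (scoped-∀ _ s) o = ctxVar∉VQ-hole C s o

  dep-on-hole⇒Vex-hole : ∀ C {χ y z} → Scoped (plug C χ) →
                         z ∈ₛ dep (plug C χ) y → z ∈ₛ VQ χ → y ∈ₛ Vex χ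
  dep-on-hole⇒Vex-hole hole {χ} _ d _ = dep⇒Vex χ d
  dep-on-hole⇒Vex-hole (∧L C φ) {χ} {y} {z} (scoped-∧ s _ _ sep) d q with ∨-elim {dep (plug C χ) y z} d
  ... | inj₁ l = dep-on-hole⇒Vex-hole C s l q
  ... | inj₂ r = ⊥-elim (sep z (dep⇒Used φ r) (VQ-plug C χ q))
  dep-on-hole⇒Vex-hole (∧R φ C) {χ} {y} {z} (scoped-∧ _ s sep _) d q with ∨-elim {dep φ y z} d
  ... | inj₁ l = ⊥-elim (sep z (dep⇒Used φ l) (VQ-plug C χ q))
  ... | inj₂ r = dep-on-hole⇒Vex-hole C s r q
  dep-on-hole⇒Vex-hole (∨L C φ) {χ} {y} {z} (scoped-∨ s _ _ sep) d q with ∨-elim {dep (plug C χ) y z} d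
  ... | inj₁ l = dep-on-hole⇒Vex-hole C s l q
  ... | inj₂ r = ⊥-elim (sep z (dep⇒Used φ r) (VQ-plug C χ q))
  dep-on-hole⇒Vex-hole (∨R φ C) {χ} {y} {z} (scoped-∨ _ s sep _) d q with ∨-elim {dep φ y z} d
  ... | inj₁ l = ⊥-elim (sep z (dep⇒Used φ l) (VQ-plug C χ q))
  ... | inj₂ r = dep-on-hole⇒Vex-hole C s r q
  dep-on-hole⇒Vex-hole (∃C v D C) {χ} {y} {z} (scoped-∃ _ _ s disj) d q with ∨-elim {⌊ v ≟ y ⌋ ∧ D z} d
  ... | inj₁ l = ⊥-elim (disj z (∧-elimʳ {⌊ v ≟ y ⌋} l) (VQ-plug C χ q))
  ... | inj₂ r = dep-on-hole⇒Vex-hole C s r q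
  dep-on-hole⇒Vex-hole (∀C v C) (scoped-∀ _ s) d q = dep-on-hole⇒Vex-hole C s d q

  clear : Fin n → Assignment n → Assignment n
  clear x α w = if ⌊ x ≟ w ⌋ then false else α w

  clear-≢ : ∀ {x w} α → x ≢ w → clear x α w ≡ α w
  clear-≢ {x} {w} α x≢w with x ≟ w
  ... | yes x≡w = ⊥-elim (x≢w x≡w)
  ... | no _    = refl

  SuppIn-if : ∀ b {f g} {S : VSet n} → SuppIn f S → (b ≢ true → SuppIn g S) →
              SuppIn (λ α → if b then f α else g α) S
  SuppIn-if true  supp-f _      = supp-f
  SuppIn-if false _      supp-g = supp-g (λ ())

  SuppIn-mono : ∀ {f} {S T : VSet n} → SuppIn f S → (∀ w → w ∈ₛ S → w ∈ₛ T) → SuppIn f T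
  SuppIn-mono supp S⊆T α β agree = supp α β (λ w → agree w ∘ S⊆T w)

  SuppIn-clear : ∀ x {f} {S T : VSet n} → SuppIn f S → (∀ w → w ∈ₛ S → x ≢ w → w ∈ₛ T) →
                 SuppIn (f ∘ clear x) T
  SuppIn-clear x {S = S} supp S∖x⊆T α β agree = supp (clear x α) (clear x β) agree-clear
    where
    agree-clear : ∀ w → w ∈ₛ S → clear x α w ≡ clear x β w
    agree-clear w p with x ≟ w
    ... | yes _   = refl
    ... | no x≢w  = agree w (S∖x⊆T w p x≢w)

  valueOf-clear : ∀ ψ {s x w} α → IsCandidate ψ s → x ≢ w → x ∉ₛ dep ψ w →
                  valueOf ψ s (clear x α) w ≡ valueOf ψ s α w
  valueOf-clear ψ {s} {x} {w} α (free , ex) x≢w x∉dep with Vall ψ w in all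
  ... | true  = clear-≢ α x≢w
  ... | false with Vex ψ w in exi
  ...   | true  = ex w exi (clear x α) α (λ { u q → clear-≢ α λ { refl → x∉dep (∧-elimˡ q) } })
  ...   | false = free w (cong not (cong₂ _∨_ exi all)) (clear x α) α (λ _ ())

module ForallScopeShrinking {n : ℕ} (C : Ctx n) (x : Fin n) (φ₁ φ₂ : Form n) where

  open ≡-Reasoning

  ψ ψ′ : Form n
  ψ  = plug C (∀ᶠ x (φ₁ ∧ᶠ φ₂))
  ψ′ = plug C (removeDep x φ₁ ∧ᶠ ∀ᶠ x φ₂)

  Vex-ψ′ : Vex ψ′ ≗ Vex ψ
  Vex-ψ′ = Vex-plug (λ w → cong (_∨ Vex φ₂ w) (Vex-removeDep x φ₁ w)) C

  Vall-ψ′ : Vall ψ′ ≗ Vall ψ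
  Vall-ψ′ = Vall-plug (λ w → trans (cong (_∨ (Vall φ₂ w ∨ ⌊ x ≟ w ⌋)) (Vall-removeDep x φ₁ w))
                                   (sym (∨-assoc (Vall φ₁ w) (Vall φ₂ w) ⌊ x ≟ w ⌋))) C

  VQ-ψ′ : VQ ψ′ ≗ VQ ψ
  VQ-ψ′ w = cong₂ _∨_ (Vex-ψ′ w) (Vall-ψ′ w)

  evalP-ψ′ : ∀ ρ → evalP ρ ψ′ ≡ evalP ρ ψ
  evalP-ψ′ ρ = begin
    evalP ρ ψ′                                              ≡⟨ evalP-plug C ρ _ ⟩
    evalCtx C ρ (evalP ρ (removeDep x φ₁) ∧ evalP ρ φ₂)   ≡⟨ cong (λ b → evalCtx C ρ (b ∧ evalP ρ φ₂))
                                                                    (evalP-removeDep x ρ φ₁) ⟩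
    evalCtx C ρ (evalP ρ φ₁ ∧ evalP ρ φ₂)                  ≡⟨ evalP-plug C ρ _ ⟨
    evalP ρ ψ                                               ∎

  support-ψ′⇒ψ : ∀ {y w} → w ∈ₛ (dep ψ′ y ∩ₛ Vall ψ′) → w ∈ₛ (dep ψ y ∩ₛ Vall ψ)
  support-ψ′⇒ψ {y} {w} q =
    ∧-intro (dep-plug-mono hole-dep C (∧-elimˡ q)) (trans (sym (Vall-ψ′ w)) (∧-elimʳ {dep ψ′ y w} q))
    where
    hole-dep : w ∈ₛ dep (removeDep x φ₁ ∧ᶠ ∀ᶠ x φ₂) y → w ∈ₛ dep (∀ᶠ x (φ₁ ∧ᶠ φ₂)) y
    hole-dep d with ∨-elim {dep (removeDep x φ₁) y w} d
    ... | inj₁ d₁ = ∨-introˡ (∧-elimˡ {dep φ₁ y w} (trans (sym (dep-removeDep x φ₁ y w)) d₁))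
    ... | inj₂ d₂ = ∨-introʳ {dep φ₁ y w} d₂

  support-ψ⇒ψ′ : ∀ {y w} → (y ∈ₛ Vex φ₁ → x ≢ w) →
                 w ∈ₛ (dep ψ y ∩ₛ Vall ψ) → w ∈ₛ (dep ψ′ y ∩ₛ Vall ψ′)
  support-ψ⇒ψ′ {y} {w} x≢w q =
    ∧-intro (dep-plug-mono hole-dep C (∧-elimˡ q)) (trans (Vall-ψ′ w) (∧-elimʳ {dep ψ y w} q))
    where
    hole-dep : w ∈ₛ dep (∀ᶠ x (φ₁ ∧ᶠ φ₂)) y → w ∈ₛ dep (removeDep x φ₁ ∧ᶠ ∀ᶠ x φ₂) y
    hole-dep d with ∨-elim {dep φ₁ y w} d
    ... | inj₁ d₁ =
      ∨-introˡ (trans (dep-removeDep x φ₁ y w) (∧-intro d₁ (cong not (∉-⟦⟧ (x≢w (dep⇒Vex φ₁ d₁))))))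
    ... | inj₂ d₂ = ∨-introʳ {dep (removeDep x φ₁) y w} d₂

  backward : Sat ψ′ → Sat ψ
  backward (s , (free , ex) , taut) = s , (free′ , ex′) , taut′
    where
    free′ : ∀ v → v ∈ₛ Vfree ψ → SuppIn (s v) ∅ₛ
    free′ v p = free v (trans (cong not (VQ-ψ′ v)) p)

    ex′ : ∀ v → v ∈ₛ Vex ψ → SuppIn (s v) (dep ψ v ∩ₛ Vall ψ)
    ex′ v p = SuppIn-mono (ex v (trans (Vex-ψ′ v) p)) (λ _ → support-ψ′⇒ψ)

    taut′ : Taut ψ s
    taut′ α = begin
      evalP (valueOf ψ s α) ψ    ≡⟨ evalP-cong ψ (λ w _ → if-cong (sym (Vall-ψ′ w))) ⟩
      evalP (valueOf ψ′ s α) ψ   ≡⟨ evalP-ψ′ _ ⟨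
      evalP (valueOf ψ′ s α) ψ′  ≡⟨ taut α ⟩
      true                       ∎

  module Forward (x∉φ₁ : x ∉ₛ Vvars φ₁) (scoped : Scoped ψ) (sep₁₂ : Sep φ₁ φ₂) (sep₂₁ : Sep φ₂ φ₁)
                 (s : Fin n → BFun n) (cand : IsCandidate ψ s) (taut : Taut ψ s) where

    s′ : Fin n → BFun n
    s′ y α = if Vex φ₁ y then s y (clear x α) else s y α

    x∈VQ-hole : x ∈ₛ VQ (∀ᶠ x (φ₁ ∧ᶠ φ₂))
    x∈VQ-hole = ∨-introʳ {Vex φ₁ x ∨ Vex φ₂ x} (∨-introʳ {Vall φ₁ x ∨ Vall φ₂ x} (∈-⟦⟧ x))

    x≢Vex-φ₁ : ∀ {w} → w ∈ₛ Vex φ₁ → x ≢ w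
    x≢Vex-φ₁ e refl = x∉φ₁ (∨-introˡ (∨-introˡ e))

    cand′ : IsCandidate ψ′ s′
    cand′ = free′ , ex′
      where
      free′ : ∀ v → v ∈ₛ Vfree ψ′ → SuppIn (s′ v) ∅ₛ
      free′ v p α β _ =
        if-cong₂ (Vex φ₁ v) (const-s (clear x α) (clear x β) (λ _ ())) (const-s α β (λ _ ()))
        where
        const-s : SuppIn (s v) ∅ₛ
        const-s = proj₁ cand v (trans (cong not (sym (VQ-ψ′ v))) p)

      ex′ : ∀ v → v ∈ₛ Vex ψ′ → SuppIn (s′ v) (dep ψ′ v ∩ₛ Vall ψ′)
      ex′ v p = SuppIn-if (Vex φ₁ v)
        (SuppIn-clear x ex-s (λ _ q x≢w → support-ψ⇒ψ′ (λ _ → x≢w) q))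
        (λ v∉φ₁ → SuppIn-mono ex-s (λ _ → support-ψ⇒ψ′ (⊥-elim ∘ v∉φ₁)))
        where
        ex-s : SuppIn (s v) (dep ψ v ∩ₛ Vall ψ)
        ex-s = proj₂ cand v (trans (sym (Vex-ψ′ v)) p)

    module _ (α : Assignment n) where

      ρ ρ₀ ρ′ : Assignment n
      ρ  = valueOf ψ s α
      ρ₀ = valueOf ψ s (clear x α)
      ρ′ = valueOf ψ′ s′ α

      ρ′≡ρ : ∀ {w} → w ∉ₛ Vex φ₁ → ρ′ w ≡ ρ w
      ρ′≡ρ {w} e₀ = trans (if-cong (Vall-ψ′ w)) (if-cong-else (Vall ψ w) (if-cong (¬-not e₀)))

      ρ′≡ρ₀ : ∀ {w} → w ∈ₛ Vex φ₁ → ρ′ w ≡ ρ₀ w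
      ρ′≡ρ₀ {w} e₁ =
        trans (if-cong (Vall-ψ′ w)) (if-cong₂ (Vall ψ w) (sym (clear-≢ α (x≢Vex-φ₁ e₁))) (if-cong e₁))

      ρ′≡ρ-ctx : ∀ {w} → w occursInCtx C → ρ′ w ≡ ρ w
      ρ′≡ρ-ctx o = ρ′≡ρ (λ e₁ → ctxVar∉VQ-hole C scoped o (∨-introˡ (∨-introˡ e₁)))

      ρ≡ρ₀-ctx : ∀ {w} → w occursInCtx C → ρ w ≡ ρ₀ w
      ρ≡ρ₀-ctx {w} o = sym (valueOf-clear ψ α cand x≢w x∉dep)
        where
        unbound : w ∉ₛ VQ (∀ᶠ x (φ₁ ∧ᶠ φ₂))
        unbound = ctxVar∉VQ-hole C scoped o
        x≢w : x ≢ w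
        x≢w refl = unbound x∈VQ-hole
        x∉dep : x ∉ₛ dep ψ w
        x∉dep d = unbound (∨-introˡ (dep-on-hole⇒Vex-hole C scoped d x∈VQ-hole))

      ρ′≡ρ₀-φ₁ : ∀ {w} → w occursIn φ₁ → ρ′ w ≡ ρ₀ w
      ρ′≡ρ₀-φ₁ {w} o with w ∈ₛ? Vex φ₁
      ... | yes w∈φ₁ = ρ′≡ρ₀ w∈φ₁
      ... | no w∉φ₁  = trans (ρ′≡ρ w∉φ₁) (sym (valueOf-clear ψ α cand x≢w x∉dep))
        where
        x≢w : x ≢ w
        x≢w refl = x∉φ₁ (occursIn⇒Vvars φ₁ o)
        x∉dep : x ∉ₛ dep ψ w
        x∉dep d with ∨-elim {Vex φ₁ w} (dep-on-hole⇒Vex-hole C scoped d x∈VQ-hole)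
        ... | inj₁ e₁ = w∉φ₁ e₁
        ... | inj₂ e₂ = sep₁₂ w (occursIn⇒Used φ₁ o) (∨-introˡ e₂)

      ρ′≡ρ-φ₂ : ∀ {w} → w occursIn φ₂ → ρ′ w ≡ ρ w
      ρ′≡ρ-φ₂ {w} o = ρ′≡ρ (λ e₁ → sep₂₁ w (occursIn⇒Used φ₂ o) (∨-introˡ e₁))

      taut′ : evalP ρ′ ψ′ ≡ true
      taut′ = begin
        evalP ρ′ ψ′                               ≡⟨ evalP-ψ′ ρ′ ⟩
        evalP ρ′ ψ                                ≡⟨ evalP-plug C ρ′ _ ⟩
        evalCtx C ρ′ (evalP ρ′ φ₁ ∧ evalP ρ′ φ₂)  ≡⟨ evalCtx-cong C _ (λ _ → ρ′≡ρ-ctx) ⟩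
        evalCtx C ρ (evalP ρ′ φ₁ ∧ evalP ρ′ φ₂)   ≡⟨ cong₂ (λ a b → evalCtx C ρ (a ∧ b))
                                                           (evalP-cong φ₁ (λ _ → ρ′≡ρ₀-φ₁))
                                                           (evalP-cong φ₂ (λ _ → ρ′≡ρ-φ₂)) ⟩
        evalCtx C ρ (evalP ρ₀ φ₁ ∧ evalP ρ φ₂)    ≡⟨ monotone-∧-swap (evalCtx C ρ) (evalCtx-monotone C ρ)
                                                           (evalP ρ φ₁) (evalP ρ φ₂) (evalP ρ₀ φ₁) (evalP ρ₀ φ₂)
                                                           holds-at-α holds-at-clear ⟩
        true                                      ∎
        where
        holds-at-α : evalCtx C ρ (evalP ρ φ₁ ∧ evalP ρ φ₂) ≡ true
        holds-at-α = trans (sym (evalP-plug C ρ _)) (taut α)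
        holds-at-clear : evalCtx C ρ (evalP ρ₀ φ₁ ∧ evalP ρ₀ φ₂) ≡ true
        holds-at-clear = trans (evalCtx-cong C _ (λ _ → ρ≡ρ₀-ctx))
                               (trans (sym (evalP-plug C ρ₀ _)) (taut (clear x α)))

  forward : x ∉ₛ Vvars φ₁ → Scoped ψ → Sep φ₁ φ₂ → Sep φ₂ φ₁ → Sat ψ → Sat ψ′
  forward x∉φ₁ scoped sep₁₂ sep₂₁ (s , cand , taut) = s′ , cand′ , taut′
    where open Forward x∉φ₁ scoped sep₁₂ sep₂₁ s cand taut

theorem9 : ∀ {n : ℕ} (C : Ctx n) (x : Fin n) (φ₁ φ₂ : Form n)
    → WF (plug C (∀ᶠ x (φ₁ ∧ᶠ φ₂)))
    → x ∉ₛ Vvars φ₁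
    → Equisat (plug C (∀ᶠ x (φ₁ ∧ᶠ φ₂)))
              (plug C (removeDep x φ₁ ∧ᶠ ∀ᶠ x φ₂))
theorem9 C x φ₁ φ₂ wf x∉φ₁ with Scoped-hole C (WF⇒Scoped wf)
... | scoped-∀ _ (scoped-∧ _ _ sep₁₂ sep₂₁) =
  (λ ¬sat sat′ → ¬sat (ForallScopeShrinking.backward C x φ₁ φ₂ sat′)) ,
  (λ ¬sat′ sat → ¬sat′ (ForallScopeShrinking.forward C x φ₁ φ₂
                          x∉φ₁ (WF⇒Scoped wf) sep₁₂ sep₂₁ sat))
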